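{- $\mathsf{H10}\preceq\mu\text{ - }\mathsf{rec}$.
   Context: A many-one reduction $P\preceq Q$ is a function $f$, definable in constructive type theory without axioms (hence computable), with $P\,x\leftrightarrow Q(f\,x)$ for all instances $x$. $\mathsf{H10}$: given $n$ and polynomials $p,q$ in variables $y_0,\dots,y_{n-1}$ with constants in $\mathbb N$, built with $+$ and $\times$, is there $\vec w\in\mathbb N^n$ with $p(\vec w)=q(\vec w)$? $\mu$-recursive algorithms of arity $k$ are built as follows. - $\mathrm{cst}_n$ has arity $0$. - $\mathrm{zero}$ and $\mathrm{succ}$ have arity $1$. - $\mathrm{prj}_p$ has arity $k$, for $p<k$. - $\mathrm{comp}\,f\,\vec g$ has arity $i$, for $f$ of arity $k$ and $\vec g$ a vector of $k$ algorithms of arity $i$. - $\mathrm{rec}\,f\,g$ has arity $1+k$, for $f$ of arity $k$ and $g$ of arity $2+k$. - $\mu f$ has arity $k$, for $f$ of arity $1+k$. Their relational semantics $[\![f]\!]\,\vec v\,x$ is defined as follows. - $[\![\mathrm{cst}_n]\!]\vec v\,x\iff x=n$. - $[\![\mathrm{zero}]\!]\vec v\,x\iff x=0$. - $[\![\mathrm{succ}]\!]\vec v\,x\iff x=v_0+1$. - $[\![\mathrm{prj}_p]\!]\vec v\,x\iff x=v_p$. - $[\![\mathrm{comp}\,f\,\vec g]\!]\vec v\,x\iff\exists\vec w,\ [\![f]\!]\vec w\,x\wedge\forall p,\ [\![g_p]\!]\vec v\,w_p$. - $[\![\mathrm{rec}\,f\,g]\!](0::\vec v)\,x\iff[\![f]\!]\vec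 v\,x$. - $[\![\mathrm{rec}\,f\,g]\!]((m+1)::\vec v)\,x\iff\exists y,\ [\![\mathrm{rec}\,f\,g]\!](m::\vec v)\,y\wedge[\![g]\!](m::y::\vec v)\,x$. - $[\![\mu f]\!]\vec v\,x\iff[\![f]\!](x::\vec v)\,0\wedge\forall y<x\,\exists z,\ [\![f]\!](y::\vec v)(1+z)$. $\mu\text{ - }\mathsf{rec}$: given $k$, an algorithm $f$ of arity $k$ and $\vec v\in\mathbb N^k$, is there $x$ with $[\![f]\!]\vec v\,x$? -}

module Defs where

open import Data.Nat using (ℕ; zero; suc; _+_; _*_; _<_)
open import Data.Fin using (Fin)
open import Data.Vec using (Vec; []; _∷_; lookup)
open import Data.Product using (Σ; ∃; _×_; _,_)
open import Function.Bundles using (_⇔_)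
open import Relation.Binary.PropositionalEquality using (_≡_)
open import Data.Unit using (⊤)
open import Level using (Level; _⊔_)

-- Many-one reductions.  Functions definable in (axiom-free, --safe)
-- Agda are computable, so a reduction is just an Agda function.

_⪯_ : ∀ {a b ℓ₁ ℓ₂} {X : Set a} {Y : Set b} →
      (X → Set ℓ₁) → (Y → Set ℓ₂) → Set (a ⊔ b ⊔ ℓ₁ ⊔ ℓ₂)
_⪯_ {X = X} {Y = Y} P Q = Σ (X → Y) λ f → ∀ x → P x ⇔ Q (f x)

data Poly (n : ℕ) : Set where
  pcst : ℕ → Poly n
  pvar : Fin n → Poly n
  padd : Poly n → Poly n → Poly n
  pmul : Poly n → Poly n → Poly n

⟦_⟧ₚ : ∀ {n} → Poly n → Vec ℕ n → ℕ
⟦ pcst c ⟧ₚ w = c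
⟦ pvar i ⟧ₚ w = lookup w i
⟦ padd p q ⟧ₚ w = ⟦ p ⟧ₚ w + ⟦ q ⟧ₚ w
⟦ pmul p q ⟧ₚ w = ⟦ p ⟧ₚ w * ⟦ q ⟧ₚ w

H10-Instance : Set
H10-Instance = Σ ℕ λ n → Poly n × Poly n

H10 : H10-Instance → Set
H10 (n , p , q) = ∃ λ (w : Vec ℕ n) → ⟦ p ⟧ₚ w ≡ ⟦ q ⟧ₚ w

data Recalg : ℕ → Set where
  cst  : ℕ → Recalg 0
  zero : Recalg 1
  succ : Recalg 1
  prj  : ∀ {k} → Fin k → Recalg k
  comp : ∀ {k i} → Recalg k → Vec (Recalg i) k → Recalg i
  rec  : ∀ {k} → Recalg k → Recalg (2 + k) → Recalg (suc k)
  mu   : ∀ {k} → Recalg (suc k) → Recalg k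

recRel : ∀ {k} → (Vec ℕ k → ℕ → Set) → (Vec ℕ (2 + k) → ℕ → Set) →
         ℕ → Vec ℕ k → ℕ → Set
recRel F G zero    v x = F v x
recRel F G (suc m) v x = ∃ λ y → recRel F G m v y × G (m ∷ y ∷ v) x

mutual
  ⟦_⟧ : ∀ {k} → Recalg k → Vec ℕ k → ℕ → Set
  ⟦ cst n ⟧ v x = x ≡ n
  ⟦ zero ⟧ v x = x ≡ 0
  ⟦ succ ⟧ (v₀ ∷ []) x = x ≡ suc v₀
  ⟦ prj p ⟧ v x = x ≡ lookup v p
  ⟦ comp f gs ⟧ v x = ∃ λ w → ⟦ f ⟧ w x × ⟦ gs ⟧ᵛ v w
  ⟦ rec f g ⟧ (m ∷ v) x = recRel ⟦ f ⟧ ⟦ g ⟧ m v x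
  ⟦ mu f ⟧ v x = ⟦ f ⟧ (x ∷ v) 0 × (∀ y → y < x → ∃ λ z → ⟦ f ⟧ (y ∷ v) (suc z))

  ⟦_⟧ᵛ : ∀ {k i} → Vec (Recalg i) k → Vec ℕ i → Vec ℕ k → Set
  ⟦ [] ⟧ᵛ v [] = ⊤
  ⟦ g ∷ gs ⟧ᵛ v (w ∷ ws) = ⟦ g ⟧ v w × ⟦ gs ⟧ᵛ v ws

μrec-Instance : Set
μrec-Instance = Σ ℕ λ k → Recalg k × Vec ℕ k

μ-rec : μrec-Instance → Set
μ-rec (k , f , v) = ∃ λ x → ⟦ f ⟧ v x

-- Product and truncated subtraction are μ-recursive, hence so is
-- B(b) = ∏ { ∣ p(w) - q(w) ∣ : w ∈ [0, b)ⁿ }, which vanishes exactly when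
-- p = q has a solution below b.  Since B is total, μ B is defined iff B
-- has a zero, i.e. iff p = q has a solution.
module Submission where

open import Defs
open import Data.Nat using (ℕ; zero; suc; _+_; _*_; _∸_; _≤_; _<_; pred; ∣_-_∣; s≤s; _≟_)
open import Data.Nat.Induction using (<-rec)
open import Data.Nat.Properties
  using ( +-comm; +-identityʳ; pred[m∸n]≡m∸[1+n]; m*n≡0⇒m≡0∨n≡0; *-zeroʳ
        ; m≤n⇒m≤1+n; m<1+n⇒m<n∨m≡n; ≤-refl; ≤-trans; m≤m+n; m≤n+m
        ; m≡n⇒∣m-n∣≡0; ∣m-n∣≡0⇒m≡n; anyUpTo?)
open import Data.Fin as Fin using (Fin; #_)
open import Data.Vec using (Vec; []; _∷_; lookup; head; tail; tabulate; sum)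
open import Data.Vec.Properties using (tabulate∘lookup)
open import Data.Vec.Relation.Unary.All as All using (All; []; _∷_)
open import Data.Product using (∃; _×_; _,_)
open import Data.Sum using (inj₁; inj₂)
open import Data.Unit using (tt)
open import Function using (_∘_; _⇔_; mk⇔; Equivalence)
open import Function.Construct.Composition using (_⇔-∘_)
open import Function.Construct.Symmetry using (⇔-sym)
open import Relation.Nullary using (¬_; Dec; yes; no; contradiction)
open import Relation.Binary.PropositionalEquality
open ≡-Reasoning

open Equivalence

private
  variable
    k i m : ℕ

record Computes (A : Recalg k) (F : Vec ℕ k → ℕ) : Set where
  field
    sound  : ∀ v → ⟦ A ⟧ v (F v)
    unique : ∀ {v x} → ⟦ A ⟧ v x → x ≡ F v
open Computes

record Computesᵛ (gs : Vec (Recalg i) k) (G : Vec ℕ i → Vec ℕ k) : Set where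
  field
    soundᵛ  : ∀ v → ⟦ gs ⟧ᵛ v (G v)
    uniqueᵛ : ∀ {v w} → ⟦ gs ⟧ᵛ v w → w ≡ G v
open Computesᵛ

computes-cong : ∀ {A : Recalg k} {F G} → Computes A F → (∀ v → F v ≡ G v) → Computes A G
sound  (computes-cong {A = A} c F≗G) v = subst (⟦ A ⟧ v) (F≗G v) (sound c v)
unique (computes-cong c F≗G) {v} h     = trans (unique c h) (F≗G v)

[]ᶜ : Computesᵛ {i} [] (λ _ → [])
soundᵛ  []ᶜ v          = tt
uniqueᵛ []ᶜ {w = []} _ = refl

infixr 5 _∷ᶜ_
_∷ᶜ_ : ∀ {g : Recalg i} {gs : Vec (Recalg i) k} {F G} →
       Computes g F → Computesᵛ gs G → Computesᵛ (g ∷ gs) (λ v → F v ∷ G v)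
soundᵛ  (c ∷ᶜ cs) v                      = sound c v , soundᵛ cs v
uniqueᵛ (c ∷ᶜ cs) {w = _ ∷ _} (h , hs) = cong₂ _∷_ (unique c h) (uniqueᵛ cs hs)

cst-computes : ∀ n → Computes (cst n) (λ _ → n)
sound  (cst-computes n) v = refl
unique (cst-computes n) e = e

succ-computes : Computes succ (suc ∘ head)
sound  succ-computes (_ ∷ [])   = refl
unique succ-computes {_ ∷ []} e = e

prj-computes : (p : Fin k) → Computes (prj p) (λ v → lookup v p)
sound  (prj-computes p) v = refl
unique (prj-computes p) e = e

comp-computes : ∀ {f : Recalg k} {gs : Vec (Recalg i) k} {F G} →
                Computes f F → Computesᵛ gs G → Computes (comp f gs) (F ∘ G)
sound  (comp-computes {G = G} cf cgs) v = G v , sound cf (G v) , soundᵛ cgs v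
unique (comp-computes cf cgs) (w , hf , hgs) with refl ← uniqueᵛ cgs hgs = unique cf hf

rec-computes : ∀ {f : Recalg k} {g : Recalg (2 + k)} {F G} (H : Vec ℕ (suc k) → ℕ) →
               Computes f F → Computes g G →
               (∀ v → H (0 ∷ v) ≡ F v) →
               (∀ m v → H (suc m ∷ v) ≡ G (m ∷ H (m ∷ v) ∷ v)) →
               Computes (rec f g) H
rec-computes {f = f} {g} H cf cg H-zero H-suc = record { sound = sound′ ; unique = unique′ }
  where
  graph : ∀ m v → recRel ⟦ f ⟧ ⟦ g ⟧ m v (H (m ∷ v))
  graph zero    v = subst (⟦ f ⟧ v) (sym (H-zero v)) (sound cf v)
  graph (suc m) v = H (m ∷ v) , graph m v , subst (⟦ g ⟧ _) (sym (H-suc m v)) (sound cg _)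

  functional : ∀ m v {x} → recRel ⟦ f ⟧ ⟦ g ⟧ m v x → x ≡ H (m ∷ v)
  functional zero    v hf = trans (unique cf hf) (sym (H-zero v))
  functional (suc m) v (y , hrec , hg) with refl ← functional m v hrec =
    trans (unique cg hg) (sym (H-suc m v))

  sound′ : ∀ v → ⟦ rec f g ⟧ v (H v)
  sound′ (m ∷ v) = graph m v

  unique′ : ∀ {v x} → ⟦ rec f g ⟧ v x → x ≡ H v
  unique′ {m ∷ v} = functional m v

const : ℕ → Recalg k
const n = comp (cst n) []

const-computes : ∀ n → Computes (const {k} n) (λ _ → n)
const-computes n = comp-computes (cst-computes n) []ᶜ

rearrange : (Fin k → Fin i) → Vec ℕ i → Vec ℕ k
rearrange σ v = tabulate (lookup v ∘ σ)

reindex : Recalg k → (Fin k → Fin i) → Recalg i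
reindex A σ = comp A (tabulate (prj ∘ σ))

tabulate-prj-computesᵛ : (σ : Fin k → Fin i) → Computesᵛ (tabulate (prj ∘ σ)) (rearrange σ)
tabulate-prj-computesᵛ {zero}  σ = []ᶜ
tabulate-prj-computesᵛ {suc k} σ = prj-computes (σ Fin.zero) ∷ᶜ tabulate-prj-computesᵛ (σ ∘ Fin.suc)

reindex-computes : ∀ {A : Recalg k} {F} (σ : Fin k → Fin i) →
                   Computes A F → Computes (reindex A σ) (F ∘ rearrange σ)
reindex-computes σ cA = comp-computes cA (tabulate-prj-computesᵛ σ)

binary : (ℕ → ℕ → ℕ) → Vec ℕ 2 → ℕ
binary _∙_ (a ∷ b ∷ []) = a ∙ b

addition : Recalg 2
addition = rec (prj (# 0)) (comp succ (prj (# 1) ∷ []))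

addition-computes : Computes addition (binary _+_)
addition-computes =
  rec-computes (binary _+_) (prj-computes (# 0)) (comp-computes succ-computes (prj-computes (# 1) ∷ᶜ []ᶜ))
    (λ { (_ ∷ []) → refl }) (λ { m (_ ∷ []) → refl })

multiplication : Recalg 2
multiplication = rec (const 0) (comp addition (prj (# 1) ∷ prj (# 2) ∷ []))

multiplication-computes : Computes multiplication (binary _*_)
multiplication-computes =
  rec-computes (binary _*_) (const-computes 0)
    (comp-computes addition-computes (prj-computes (# 1) ∷ᶜ prj-computes (# 2) ∷ᶜ []ᶜ))
    (λ { (_ ∷ []) → refl }) (λ { m (b ∷ []) → +-comm b (m * b) })

predecessor : Recalg 1
predecessor = rec (cst 0) (prj (# 0))

predecessor-computes : Computes predecessor (pred ∘ head)
predecessor-computes =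
  rec-computes (pred ∘ head) (cst-computes 0) (prj-computes (# 0)) (λ { [] → refl }) (λ { m [] → refl })

-- The recursion runs on the subtrahend, which therefore comes first.
monus : Recalg 2
monus = rec (prj (# 0)) (comp predecessor (prj (# 1) ∷ []))

monus-computes : Computes monus (binary (λ b a → a ∸ b))
monus-computes =
  rec-computes (binary (λ b a → a ∸ b)) (prj-computes (# 0))
    (comp-computes predecessor-computes (prj-computes (# 1) ∷ᶜ []ᶜ))
    (λ { (_ ∷ []) → refl }) (λ { b (a ∷ []) → sym (pred[m∸n]≡m∸[1+n] a b) })

∣m-n∣≡m∸n+n∸m : ∀ m n → ∣ m - n ∣ ≡ (m ∸ n) + (n ∸ m)
∣m-n∣≡m∸n+n∸m zero    zero    = refl
∣m-n∣≡m∸n+n∸m zero    (suc n) = refl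
∣m-n∣≡m∸n+n∸m (suc m) zero    = sym (+-identityʳ (suc m))
∣m-n∣≡m∸n+n∸m (suc m) (suc n) = ∣m-n∣≡m∸n+n∸m m n

distance : Recalg 2
distance = comp addition ( comp monus (prj (# 1) ∷ prj (# 0) ∷ [])
                         ∷ comp monus (prj (# 0) ∷ prj (# 1) ∷ []) ∷ [])

distance-computes : Computes distance (binary ∣_-_∣)
distance-computes = computes-cong
  (comp-computes addition-computes
    ( comp-computes monus-computes (prj-computes (# 1) ∷ᶜ prj-computes (# 0) ∷ᶜ []ᶜ)
    ∷ᶜ comp-computes monus-computes (prj-computes (# 0) ∷ᶜ prj-computes (# 1) ∷ᶜ []ᶜ) ∷ᶜ []ᶜ))
  λ { (a ∷ b ∷ []) → sym (∣m-n∣≡m∸n+n∸m a b) }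

poly : ∀ {n} → Poly n → Recalg n
poly (pcst c)   = const c
poly (pvar x)   = prj x
poly (padd p q) = comp addition (poly p ∷ poly q ∷ [])
poly (pmul p q) = comp multiplication (poly p ∷ poly q ∷ [])

poly-computes : ∀ {n} (p : Poly n) → Computes (poly p) ⟦ p ⟧ₚ
poly-computes (pcst c)   = const-computes c
poly-computes (pvar x)   = prj-computes x
poly-computes (padd p q) = comp-computes addition-computes (poly-computes p ∷ᶜ poly-computes q ∷ᶜ []ᶜ)
poly-computes (pmul p q) = comp-computes multiplication-computes (poly-computes p ∷ᶜ poly-computes q ∷ᶜ []ᶜ)

∏< : (Vec ℕ (suc k) → ℕ) → Vec ℕ (suc k) → ℕ
∏< T (zero  ∷ v) = 1
∏< T (suc c ∷ v) = ∏< T (c ∷ v) * T (c ∷ v)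

∏<≡0⇔ : ∀ (T : Vec ℕ (suc k) → ℕ) c v → ∏< T (c ∷ v) ≡ 0 ⇔ ∃ λ y → y < c × T (y ∷ v) ≡ 0
∏<≡0⇔ T c v = mk⇔ (to′ c) (from′ c)
  where
  to′ : ∀ c → ∏< T (c ∷ v) ≡ 0 → ∃ λ y → y < c × T (y ∷ v) ≡ 0
  to′ (suc c) e with m*n≡0⇒m≡0∨n≡0 (∏< T (c ∷ v)) e
  ... | inj₁ e′ = let y , y<c , Ty≡0 = to′ c e′ in y , m≤n⇒m≤1+n y<c , Ty≡0
  ... | inj₂ e′ = c , ≤-refl , e′

  from′ : ∀ c → (∃ λ y → y < c × T (y ∷ v) ≡ 0) → ∏< T (c ∷ v) ≡ 0
  from′ (suc c) (y , y<1+c , Ty≡0) with m<1+n⇒m<n∨m≡n y<1+c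
  ... | inj₁ y<c  rewrite from′ c (y , y<c , Ty≡0) = refl
  ... | inj₂ refl rewrite Ty≡0 = *-zeroʳ (∏< T (y ∷ v))

∏<-cong : ∀ {T : Vec ℕ (suc k) → ℕ} {T′ : Vec ℕ (suc i) → ℕ} {v v′} →
          (∀ y → T (y ∷ v) ≡ T′ (y ∷ v′)) → ∀ c → ∏< T (c ∷ v) ≡ ∏< T′ (c ∷ v′)
∏<-cong T≗T′ zero    = refl
∏<-cong T≗T′ (suc c) = cong₂ _*_ (∏<-cong T≗T′ c) (T≗T′ c)

skip-second : Fin (suc k) → Fin (2 + k)
skip-second Fin.zero    = Fin.zero
skip-second (Fin.suc x) = Fin.suc (Fin.suc x)

product : Recalg (suc k) → Recalg (suc k)
product t = rec (const 1) (comp multiplication (prj (# 1) ∷ reindex t skip-second ∷ []))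

product-computes : ∀ {t : Recalg (suc k)} {T} → Computes t T → Computes (product t) (∏< T)
product-computes {T = T} ct =
  rec-computes (∏< T) (const-computes 1)
    (comp-computes multiplication-computes (prj-computes (# 1) ∷ᶜ reindex-computes skip-second ct ∷ᶜ []ᶜ))
    (λ v → refl) (λ c v → cong (λ u → ∏< T (c ∷ v) * T (c ∷ u)) (sym (tabulate∘lookup v)))

∏<-second : (Vec ℕ (2 + m) → ℕ) → Vec ℕ (suc m) → ℕ
∏<-second F (b ∷ w) = ∏< (F ∘ (b ∷_)) (b ∷ w)

swap : Fin (2 + m) → Fin (2 + m)
swap Fin.zero               = Fin.suc Fin.zero
swap (Fin.suc Fin.zero)     = Fin.zero
swap (Fin.suc (Fin.suc x))  = Fin.suc (Fin.suc x)

duplicate-head : Fin (2 + m) → Fin (suc m)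
duplicate-head Fin.zero    = Fin.zero
duplicate-head (Fin.suc x) = x

product-second : Recalg (2 + m) → Recalg (suc m)
product-second A = reindex (product (reindex A swap)) duplicate-head

product-second-computes : ∀ {A : Recalg (2 + m)} {F} → Computes A F → Computes (product-second A) (∏<-second F)
product-second-computes {F = F} cA =
  computes-cong (reindex-computes duplicate-head (product-computes (reindex-computes swap cA)))
    λ { (b ∷ w) → begin
      ∏< (F ∘ rearrange swap) (b ∷ b ∷ tabulate (lookup w))
        ≡⟨ cong (λ u → ∏< (F ∘ rearrange swap) (b ∷ b ∷ u)) (tabulate∘lookup w) ⟩
      ∏< (F ∘ rearrange swap) (b ∷ b ∷ w)
        ≡⟨ ∏<-cong (λ y → cong (λ u → F (b ∷ y ∷ u)) (tabulate∘lookup w)) b ⟩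
      ∏<-second F (b ∷ w) ∎ }

-- ∏<-all n F (b ∷ []) = ∏_{w ∈ [0, b)ⁿ} F (b ∷ w)
∏<-all : ∀ n → (Vec ℕ (suc n) → ℕ) → Vec ℕ 1 → ℕ
∏<-all zero    F = F
∏<-all (suc n) F = ∏<-all n (∏<-second F)

∏<-all≡0⇔ : ∀ n (F : Vec ℕ (suc n) → ℕ) b →
            ∏<-all n F (b ∷ []) ≡ 0 ⇔ ∃ λ (w : Vec ℕ n) → All (_< b) w × F (b ∷ w) ≡ 0
∏<-all≡0⇔ zero F b = mk⇔ (λ e → [] , [] , e) (λ { ([] , [] , e) → e })
∏<-all≡0⇔ (suc n) F b = mk⇔ to′ from′
  where
  IH : ∏<-all n (∏<-second F) (b ∷ []) ≡ 0 ⇔ ∃ λ w → All (_< b) w × ∏<-second F (b ∷ w) ≡ 0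
  IH = ∏<-all≡0⇔ n (∏<-second F) b

  step : ∀ w → ∏<-second F (b ∷ w) ≡ 0 ⇔ ∃ λ y → y < b × F (b ∷ y ∷ w) ≡ 0
  step = ∏<≡0⇔ (F ∘ (b ∷_)) b

  to′ : ∏<-all (suc n) F (b ∷ []) ≡ 0 → ∃ λ w → All (_< b) w × F (b ∷ w) ≡ 0
  to′ e = let w , w<b , e′ = to IH e; y , y<b , e″ = to (step w) e′ in y ∷ w , y<b ∷ w<b , e″

  from′ : (∃ λ w → All (_< b) w × F (b ∷ w) ≡ 0) → ∏<-all (suc n) F (b ∷ []) ≡ 0
  from′ (y ∷ w , y<b ∷ w<b , e) = from IH (w , w<b , from (step w) (y , y<b , e))

product-all : ∀ n → Recalg (suc n) → Recalg 1
product-all zero    A = A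
product-all (suc n) A = product-all n (product-second A)

product-all-computes : ∀ n {A : Recalg (suc n)} {F} → Computes A F → Computes (product-all n A) (∏<-all n F)
product-all-computes zero    cA = cA
product-all-computes (suc n) cA = product-all-computes n (product-second-computes cA)

All-≤-sum : ∀ {n} (w : Vec ℕ n) → All (_≤ sum w) w
All-≤-sum []      = []
All-≤-sum (x ∷ w) = m≤m+n x (sum w) ∷ All.map (λ y≤ → ≤-trans y≤ (m≤n+m (sum w) x)) (All-≤-sum w)

∃≡0⇔∃∏<-all≡0 : ∀ {n} (F : Vec ℕ n → ℕ) → (∃ λ w → F w ≡ 0) ⇔ (∃ λ b → ∏<-all n (F ∘ tail) (b ∷ []) ≡ 0)
∃≡0⇔∃∏<-all≡0 {n} F = mk⇔
  (λ (w , e) → suc (sum w) , from (∏<-all≡0⇔ n (F ∘ tail) _) (w , All.map s≤s (All-≤-sum w) , e))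
  (λ (b , e) → let w , _ , e′ = to (∏<-all≡0⇔ n (F ∘ tail) b) e in w , e′)

Least : (ℕ → Set) → ℕ → Set
Least P x = P x × (∀ {y} → y < x → ¬ P y)

least-witness : ∀ {P : ℕ → Set} → (∀ n → Dec (P n)) → ∀ {b} → P b → ∃ (Least P)
least-witness {P} P? {b} = <-rec (λ b → P b → ∃ (Least P)) search b
  where
  search : ∀ b → (∀ {c} → c < b → P c → ∃ (Least P)) → P b → ∃ (Least P)
  search b below Pb with anyUpTo? P? b
  ... | yes (c , c<b , Pc) = below c<b Pc
  ... | no  ∄c             = b , Pb , λ y<b Py → ∄c (_ , y<b , Py)

-- Totality of F is what makes every value below the least zero a successor.
mu-defined⇔ : ∀ {f : Recalg (suc k)} {F} {v} → Computes f F →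
              (∃ λ x → ⟦ mu f ⟧ v x) ⇔ (∃ λ x → F (x ∷ v) ≡ 0)
mu-defined⇔ {f = f} {F} {v} cf = mk⇔
  (λ (x , f≡0 , _) → x , sym (unique cf f≡0))
  (λ (b , e) → let x , Fx≡0 , below = least-witness (λ y → F (y ∷ v) ≟ 0) e in
     x , subst (⟦ f ⟧ (x ∷ v)) Fx≡0 (sound cf (x ∷ v)) , λ y y<x → positive y (below y<x))
  where
  positive : ∀ y → ¬ F (y ∷ v) ≡ 0 → ∃ λ z → ⟦ f ⟧ (y ∷ v) (suc z)
  positive y Fy≢0 with F (y ∷ v) | sound cf (y ∷ v)
  ... | zero  | _  = contradiction refl Fy≢0
  ... | suc z | fy = z , fy

solvable⇔∃distance≡0 : ∀ {n} (p q : Poly n) → H10 (n , p , q) ⇔ (∃ λ w → ∣ ⟦ p ⟧ₚ w - ⟦ q ⟧ₚ w ∣ ≡ 0)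
solvable⇔∃distance≡0 p q = mk⇔ (λ (w , e) → w , m≡n⇒∣m-n∣≡0 e) (λ (w , e) → w , ∣m-n∣≡0⇒m≡n e)

equation : ∀ {n} → Poly n → Poly n → Recalg (suc n)
equation p q = reindex (comp distance (poly p ∷ poly q ∷ [])) Fin.suc

equation-computes : ∀ {n} (p q : Poly n) →
                    Computes (equation p q) (λ v → ∣ ⟦ p ⟧ₚ (tail v) - ⟦ q ⟧ₚ (tail v) ∣)
equation-computes p q = computes-cong
  (reindex-computes Fin.suc
    (comp-computes distance-computes (poly-computes p ∷ᶜ poly-computes q ∷ᶜ []ᶜ)))
  λ { (b ∷ w) → cong (λ u → ∣ ⟦ p ⟧ₚ u - ⟦ q ⟧ₚ u ∣) (tabulate∘lookup w) }

reduction : H10-Instance → μrec-Instance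
reduction (n , p , q) = 0 , mu (product-all n (equation p q)) , []

corollary10p11 : H10 ⪯ μ-rec
corollary10p11 = reduction , λ (n , p , q) →
  ⇔-sym (mu-defined⇔ (product-all-computes n (equation-computes p q)))
    ⇔-∘ (∃≡0⇔∃∏<-all≡0 (λ w → ∣ ⟦ p ⟧ₚ w - ⟦ q ⟧ₚ w ∣) ⇔-∘ solvable⇔∃distance≡0 p q)
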